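{- Let $\Gamma=\langle\rho_0,\rho_1,\rho_2\rangle$ be an sggi with $\sigma_1=\rho_0\rho_1$ and $\sigma_2=\rho_1\rho_2$. Suppose that $g_1\cdots g_m=h_1\cdots h_n$, where each $g_k$ and each $h_k$ lies in $\{\sigma_1,\rho_1,\sigma_2\}$. Then $g_m\cdots g_1=h_n\cdots h_1$.
   Context: An sggi (string group generated by involutions) of rank 3 is a group $\Gamma=\langle\rho_0,\rho_1,\rho_2\rangle$ with distinguished generators each of order 2 satisfying $(\rho_0\rho_2)^2=1$. -}

module Defs where

open import Level using (Level)
open import Algebra.Bundles using (Group)
open import Data.Fin using (Fin; zero; suc)
open import Data.List using (List; []; _∷_; foldr)
open import Data.Product using (∃; _×_)
open import Relation.Nullary using (¬_)

module _ {c ℓ : Level} (G : Group c ℓ) where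
  open Group G

  IsInvolution : Carrier → Set ℓ
  IsInvolution x = (¬ (x ≈ ε)) × (x ∙ x ≈ ε)

  evalGen : (Fin 3 → Carrier) → List (Fin 3) → Carrier
  evalGen ρ = foldr (λ i x → ρ i ∙ x) ε

  record IsSggi3 (ρ : Fin 3 → Carrier) : Set (c Level.⊔ ℓ) where
    field
      involutions : (i : Fin 3) → IsInvolution (ρ i)
      string      : (ρ zero ∙ ρ (suc (suc zero))) ∙ (ρ zero ∙ ρ (suc (suc zero))) ≈ ε
      generates   : (g : Carrier) → ∃ λ (w : List (Fin 3)) → evalGen ρ w ≈ g

data Letter : Set where
  σ₁ ρ₁ σ₂ : Letter

module _ {c ℓ : Level} (G : Group c ℓ) (ρ : Fin 3 → Group.Carrier G) where
  open Group G

  letter : Letter → Carrier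
  letter σ₁ = ρ zero ∙ ρ (suc zero)
  letter ρ₁ = ρ (suc zero)
  letter σ₂ = ρ (suc zero) ∙ ρ (suc (suc zero))

  evalWord : List Letter → Carrier
  evalWord = foldr (λ a x → letter a ∙ x) ε

-- Conjugation by ρ₁ composed with inversion, x ↦ ρ₁ x⁻¹ ρ₁, is an anti-automorphism of Γ
-- that fixes each of σ₁ = ρ₀ρ₁, ρ₁ and σ₂ = ρ₁ρ₂. Hence it sends g₁ ⋯ gₘ to gₘ ⋯ g₁, and
-- applying it to both sides of g₁ ⋯ gₘ = h₁ ⋯ hₙ gives the claim.
module Submission where

open import Defs
open import Level using (Level)
open import Algebra.Bundles using (Monoid; Group)
open import Algebra.Morphism.Structures using (module MonoidMorphisms)
open import Data.Fin using (Fin; zero; suc)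
open import Data.List using (List; reverse; []; _∷_; _++_; [_]; foldr)
open import Data.List.Properties using (unfold-reverse)
open import Data.Product using (proj₂)
import Algebra.Construct.Flip.Op as Op
import Algebra.Properties.Group as GroupProperties
import Relation.Binary.Reasoning.Setoid as SetoidReasoning
open import Relation.Binary.PropositionalEquality using (cong)

module WordProduct {c ℓ a : Level} (M : Monoid c ℓ) {A : Set a} (L : A → Monoid.Carrier M) where
  open Monoid M
  open SetoidReasoning setoid
  -- anti-homomorphisms of M are encoded as homomorphisms into the opposite monoid
  open MonoidMorphisms rawMonoid (Monoid.rawMonoid (Op.monoid M))

  product : List A → Carrier
  product = foldr (λ x p → L x ∙ p) ε

  product-++ : ∀ xs ys → product (xs ++ ys) ≈ product xs ∙ product ys
  product-++ [] ys = sym (identityˡ (product ys))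
  product-++ (x ∷ xs) ys = begin
    L x ∙ product (xs ++ ys)          ≈⟨ ∙-congˡ (product-++ xs ys) ⟩
    L x ∙ (product xs ∙ product ys)   ≈⟨ assoc (L x) (product xs) (product ys) ⟨
    (L x ∙ product xs) ∙ product ys   ∎

  antihomomorphism-reverses : {f : Carrier → Carrier} → IsMonoidHomomorphism f →
    (∀ x → f (L x) ≈ L x) → ∀ w → f (product w) ≈ product (reverse w)
  antihomomorphism-reverses isAnti fixed [] = IsMonoidHomomorphism.ε-homo isAnti
  antihomomorphism-reverses {f} isAnti fixed (x ∷ w) = begin
    f (L x ∙ product w)                  ≈⟨ homo (L x) (product w) ⟩
    f (product w) ∙ f (L x)              ≈⟨ ∙-cong (antihomomorphism-reverses isAnti fixed w) (fixed x) ⟩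
    product (reverse w) ∙ L x            ≈⟨ ∙-congˡ (identityʳ (L x)) ⟨
    product (reverse w) ∙ product [ x ]  ≈⟨ product-++ (reverse w) [ x ] ⟨
    product (reverse w ++ [ x ])         ≡⟨ cong product (unfold-reverse x w) ⟨
    product (reverse (x ∷ w))            ∎
    where open IsMonoidHomomorphism isAnti

module Reflection {c ℓ : Level} (G : Group c ℓ) {b : Group.Carrier G} (b∙b≈ε : Group._≈_ G (Group._∙_ G b b) (Group.ε G)) where
  open Group G
  open GroupProperties G
  open SetoidReasoning setoid
  open MonoidMorphisms rawMonoid (Monoid.rawMonoid (Op.monoid monoid))

  reflect : Carrier → Carrier
  reflect x = b ∙ (x ⁻¹ ∙ b)

  reflect-cong : ∀ {x y} → x ≈ y → reflect x ≈ reflect y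
  reflect-cong x≈y = ∙-congˡ (∙-congʳ (⁻¹-cong x≈y))

  b-cancelˡ : ∀ x → b ∙ (b ∙ x) ≈ x
  b-cancelˡ x = trans (sym (assoc b b x)) (trans (∙-congʳ b∙b≈ε) (identityˡ x))

  b-cancelʳ : ∀ x → (x ∙ b) ∙ b ≈ x
  b-cancelʳ x = trans (assoc x b b) (trans (∙-congˡ b∙b≈ε) (identityʳ x))

  reflect-anti-homo : ∀ x y → reflect (x ∙ y) ≈ reflect y ∙ reflect x
  reflect-anti-homo x y = begin
    b ∙ ((x ∙ y) ⁻¹ ∙ b)               ≈⟨ ∙-congˡ (∙-congʳ (⁻¹-anti-homo-∙ x y)) ⟩
    b ∙ ((y ⁻¹ ∙ x ⁻¹) ∙ b)            ≈⟨ ∙-congˡ (assoc (y ⁻¹) (x ⁻¹) b) ⟩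
    b ∙ (y ⁻¹ ∙ (x ⁻¹ ∙ b))            ≈⟨ ∙-congˡ (∙-congˡ (b-cancelˡ (x ⁻¹ ∙ b))) ⟨
    b ∙ (y ⁻¹ ∙ (b ∙ reflect x))       ≈⟨ ∙-congˡ (assoc (y ⁻¹) b (reflect x)) ⟨
    b ∙ ((y ⁻¹ ∙ b) ∙ reflect x)       ≈⟨ assoc b (y ⁻¹ ∙ b) (reflect x) ⟨
    reflect y ∙ reflect x              ∎

  reflect-isAntihomomorphism : IsMonoidHomomorphism reflect
  reflect-isAntihomomorphism = record
    { isMagmaHomomorphism = record
      { isRelHomomorphism = record { cong = reflect-cong }
      ; homo = reflect-anti-homo
      }
    ; ε-homo = trans (∙-congˡ (trans (∙-congʳ ε⁻¹≈ε) (identityˡ b))) b∙b≈ε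
    }

  reflect-b : reflect b ≈ b
  reflect-b = trans (∙-congˡ (inverseˡ b)) (identityʳ b)

  reflect-involution : ∀ {x} → x ∙ x ≈ ε → reflect x ≈ b ∙ (x ∙ b)
  reflect-involution {x} x∙x≈ε = ∙-congˡ (∙-congʳ (sym (inverseˡ-unique x x x∙x≈ε)))

  reflect-fixes-∙b : ∀ {x} → x ∙ x ≈ ε → reflect (x ∙ b) ≈ x ∙ b
  reflect-fixes-∙b {x} x∙x≈ε = begin
    reflect (x ∙ b)           ≈⟨ reflect-anti-homo x b ⟩
    reflect b ∙ reflect x     ≈⟨ ∙-cong reflect-b (reflect-involution x∙x≈ε) ⟩
    b ∙ (b ∙ (x ∙ b))         ≈⟨ b-cancelˡ (x ∙ b) ⟩
    x ∙ b                     ∎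

  reflect-fixes-b∙ : ∀ {x} → x ∙ x ≈ ε → reflect (b ∙ x) ≈ b ∙ x
  reflect-fixes-b∙ {x} x∙x≈ε = begin
    reflect (b ∙ x)           ≈⟨ reflect-anti-homo b x ⟩
    reflect x ∙ reflect b     ≈⟨ ∙-cong (reflect-involution x∙x≈ε) reflect-b ⟩
    (b ∙ (x ∙ b)) ∙ b         ≈⟨ assoc b (x ∙ b) b ⟩
    b ∙ ((x ∙ b) ∙ b)         ≈⟨ ∙-congˡ (b-cancelʳ x) ⟩
    b ∙ x                     ∎

module _ {c ℓ : Level} (Γ : Group c ℓ) (ρ : Fin 3 → Group.Carrier Γ) (sggi : IsSggi3 Γ ρ) where
  open Group Γ
  open IsSggi3 sggi using (involutions)

  ρ²≈ε : ∀ i → ρ i ∙ ρ i ≈ ε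
  ρ²≈ε i = proj₂ (involutions i)

  open Reflection Γ (ρ²≈ε (suc zero))
  open WordProduct monoid (letter Γ ρ)

  reflect-fixes-letter : ∀ x → reflect (letter Γ ρ x) ≈ letter Γ ρ x
  reflect-fixes-letter σ₁ = reflect-fixes-∙b (ρ²≈ε zero)
  reflect-fixes-letter ρ₁ = reflect-b
  reflect-fixes-letter σ₂ = reflect-fixes-b∙ (ρ²≈ε (suc (suc zero)))

  reflect-evalWord : ∀ w → reflect (evalWord Γ ρ w) ≈ evalWord Γ ρ (reverse w)
  reflect-evalWord = antihomomorphism-reverses reflect-isAntihomomorphism reflect-fixes-letter

proposition3p1 : {c ℓ : Level} (Γ : Group c ℓ) (ρ : Fin 3 → Group.Carrier Γ) →
    IsSggi3 Γ ρ → (g h : List Letter) →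
    Group._≈_ Γ (evalWord Γ ρ g) (evalWord Γ ρ h) →
    Group._≈_ Γ (evalWord Γ ρ (reverse g)) (evalWord Γ ρ (reverse h))
proposition3p1 Γ ρ sggi g h g≈h = begin
  evalWord Γ ρ (reverse g)    ≈⟨ reflect-evalWord Γ ρ sggi g ⟨
  reflect (evalWord Γ ρ g)    ≈⟨ reflect-cong g≈h ⟩
  reflect (evalWord Γ ρ h)    ≈⟨ reflect-evalWord Γ ρ sggi h ⟩
  evalWord Γ ρ (reverse h)    ∎
  where
  open Group Γ using (setoid)
  open SetoidReasoning setoid
  open Reflection Γ (ρ²≈ε Γ ρ sggi (suc zero))
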